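{- Let $\mathcal{C}=(c_{i,j})$ be a frieze with coefficients on an $n$-gon over the positive integers, with vertices $0,1,\dots,n-1$ in counterclockwise order, satisfying: (1) $\gcd(a,b)=\gcd(b,c)=\gcd(a,c)$ for every triangle with side labels $a,b,c$; (2) for every prime $q<n$ and every $(q+1)$-subpolygon, its labels are either all not divisible by $q$ or do not all have the same $q$-valuation. Put $c_0:=c_{0,n-1}>1$ and $c_j:=c_{j,n-1}$ for $0\le j\le n-2$. Let $p$ be a prime divisor of $c_0$, $\ell:=\nu_p(c_0)$, $m:=\min\{\nu_p(c_i)\mid 0\le i\le n-2\}$, and choose $i_p\in\{0,\dots,n-2\}$ with $\nu_p(c_{i_p})=m$. For a positive integer $u$ write $u=p^{\nu_p(u)}u'$, and let $(c'_{i_p})^{ -1}$ denote an inverse of $c'_{i_p}$ modulo $p^\ell$. Fix a positive integer $y_{i_p}$ with $y_{i_p}\not\equiv0\pmod p$ such that for every vertex $j\ne i_p$ in $\{0,\dots,n-2\}$ with $p\nmid c_{i_p,j}/p^m$ and $p\nmid c_j/p^m$ we have $c'_jy_{i_p}-c'_{i_p,j}\not\equiv0\pmod p$ if $j<i_p$ and $c'_jy_{i_p}+c'_{i_p,j}\not\equiv0\pmod p$ if $i_p<j$. For each $j\in\{0,\dots,n-2\}$, $j\neq i_p$, let $y_j$ be any integer with $y_j\equiv (c'_{i_p})^{ -1}\big(\tfrac{c_j}{p^m}y_{i_p}-\tfrac{c_{i_p,j}}{p^m}\big)\pmod{p^\ell}$ if $j<i_p$, and $y_j\equiv (c'_{i_p})^{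 -1}\big(\tfrac{c_j}{p^m}y_{i_p}+\tfrac{c_{i_p,j}}{p^m}\big)\pmod{p^\ell}$ if $i_p<j$. Then for all $j\in\{0,\dots,n-2\}$: (a) $p\nmid\gcd(y_j,c_j)$; (b) for every $0\le i<j$ we have $c_iy_j\equiv c_jy_i+c_{i,j}\pmod{p^\ell}$.
   Context: A frieze with coefficients on the $n$-gon (vertices $0,\dots,n-1$ in cyclic order) over a set $R$ is a map assigning to each edge or diagonal $\{i,j\}$ a value $c_{i,j}=c_{j,i}\in R$ such that $c_{i,k}c_{j,\ell}=c_{i,\ell}c_{j,k}+c_{i,j}c_{k,\ell}$ for all vertices $i<j<k<\ell$. A $k$-subpolygon is the restriction to edges and diagonals among a set of $k$ vertices; a triangle is a 3-subpolygon. $\nu_p(u)$ denotes the exponent of the prime $p$ in the positive integer $u$. -}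

module Defs where

open import Data.Nat as ℕ using (ℕ; zero; suc; _+_; _*_; _<_; _^_; _/_)
open import Data.Nat.Divisibility using (_∣?_) renaming (_∣_ to _∣ℕ_)
open import Data.Nat.Primality using (Prime)
open import Data.Nat.GCD using (gcd)
open import Data.Bool using (if_then_else_)
open import Data.Fin using (Fin)
import Data.Fin as Fin
open import Data.Integer as ℤ using (ℤ)
open import Data.Integer.Divisibility as ℤD using ()
open import Data.Product using (_×_; ∃)
open import Data.Sum using (_⊎_)
open import Relation.Nullary using (¬_; does)
open import Relation.Binary.PropositionalEquality using (_≡_)

-- exact quotient u / d (total: returns 0 when d = 0; only used with d ≠ 0)
quot : ℕ → ℕ → ℕ
quot u zero    = 0
quot u (suc d) = u / suc d

νgo : ℕ → ℕ → ℕ → ℕ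
νgo zero    p u = 0
νgo (suc f) p u = if does (p ∣? u) then suc (νgo f p (quot u p)) else 0

-- ν p u = exponent of p in u (for p prime and u positive; fuel u suffices)
ν : ℕ → ℕ → ℕ
ν p u = νgo u p u

part : ℕ → ℕ → ℕ
part p u = quot u (p ^ ν p u)

infix 4 _≡_[mod_]
_≡_[mod_] : ℤ → ℤ → ℕ → Set
a ≡ b [mod k ] = ℤ.+ k ℤD.∣ (a ℤ.- b)

-- frieze with coefficients on the n-gon (vertices 0..n-1) over the positive
-- integers; labels c i j only matter for distinct vertices i, j < n
record IsPosFrieze (n : ℕ) (c : ℕ → ℕ → ℕ) : Set where
  field
    positive : ∀ i j → i < j → j < n → 0 < c i j
    symm     : ∀ i j → i < n → j < n → c i j ≡ c j i
    ptolemy  : ∀ i j k l → i < j → j < k → k < l → l < n →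
               c i k * c j l ≡ c i l * c j k + c i j * c k l

TriangleGcd : ℕ → (ℕ → ℕ → ℕ) → Set
TriangleGcd n c = ∀ i j k → i < j → j < k → k < n →
  (gcd (c i j) (c j k) ≡ gcd (c j k) (c i k)) × (gcd (c j k) (c i k) ≡ gcd (c i j) (c i k))

record SubPolygon (n k : ℕ) : Set where
  field
    vert    : Fin k → ℕ
    incr    : ∀ a b → a Fin.< b → vert a < vert b
    inRange : ∀ a → vert a < n

SubpolygonValuation : ℕ → (ℕ → ℕ → ℕ) → Set
SubpolygonValuation n c = ∀ q → Prime q → q < n → (S : SubPolygon n (suc q)) →
  let open SubPolygon S in
  (∀ a b → a Fin.< b → ¬ (q ∣ℕ c (vert a) (vert b)))
  ⊎ ¬ (∃ λ v → ∀ a b → a Fin.< b → ν q (c (vert a) (vert b)) ≡ v)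

module Submission where

open import Defs
open import Data.Nat using (ℕ; _<_; _≤_; _∸_; _^_)
open import Data.Nat.Divisibility using (_∣_)
open import Data.Nat.Primality using (Prime)
open import Data.Integer using (ℤ; +_; _+_; _-_; _*_; +<+) renaming (_<_ to _<ℤ_)
open import Data.Integer.GCD using () renaming (gcd to gcdℤ)
import Data.Integer.Divisibility as ℤD
open import Data.Product using (_×_)
open import Relation.Nullary using (¬_)
open import Relation.Binary.PropositionalEquality using (_≡_; _≢_)

import Data.Nat as ℕ
import Data.Nat.Properties as ℕₚ
open import Data.Nat using (zero; suc; z<s; s≤s; _/_)
open import Data.Nat.Properties using (<-cmp; <-trans; <-irrefl; <-asym)
open import Data.Nat.Base using (>-nonZero; nonTrivial⇒n>1)
open import Data.Nat.DivMod using (m*[n/m]≡n; m*n/n≡m)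
open import Data.Nat.Divisibility using (_∣?_; divides; _∣0; 0∣⇒≡0; ∣-refl; ∣-trans; ∣m⇒∣m*n; *-monoʳ-∣; *-cancelˡ-∣)
open import Data.Nat.GCD using (gcd; gcd-greatest; gcd[m,n]∣m; gcd[m,n]∣n)
open import Data.Nat.Primality using (euclidsLemma; prime⇒nonTrivial)
open import Data.Integer using (0ℤ; 1ℤ; -_; ∣_∣; NonZero)
open import Data.Integer.Properties
  using (pos-*; pos-+; *-comm; *-assoc; *-zeroʳ; *-cancelˡ-≡; +-identityʳ;
         neg-distribʳ-*; neg-involutive; abs-*; i≡j⇒i-j≡0)
open import Data.Integer.GCD using (gcd[i,j]∣i)
import Data.Integer.Divisibility.Signed as ℤ∣
open import Data.Integer.Tactic.RingSolver using (solve-∀)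
open import Data.Product using (Σ; _,_; proj₁; proj₂)
open import Data.Sum using (_⊎_; inj₁; inj₂)
open import Data.Empty using (⊥; ⊥-elim)
open import Relation.Nullary using (yes; no)
open import Relation.Binary.Definitions using (tri<; tri≈; tri>)
open import Relation.Binary.PropositionalEquality
  using (refl; sym; trans; cong; cong₂; subst; subst₂; module ≡-Reasoning)

-- Let N = n - 1 be the apex, c_k = c(k,N)
-- the legs, m the least p-valuation of a leg (attained at the pivot ip), M = p ^ m
-- and P = p ^ ℓ with ℓ = ν_p(c_0). By condition (1) M divides every chord c(ip,k)
-- as well, giving reduced legs A k = c_k / M, reduced chords B k = c(ip,k) / M and
-- the reduced signed chord s k (-B k below ip, 0 at ip, B k above ip). The choice
-- of y in the statement says y_k ≡ inv · X k (mod P) where X k = A k · y_ip + s k.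
--  (b) The Ptolemy relations of the quadrilaterals through ip and N combine into
--      one signed relation c_i σ_k - c_k σ_i = c_ip c_ik (σ = M s). Dividing by M
--      gives c_i X k - c_k X i = A_ip c_ik exactly, and multiplying by inv, which
--      inverts A_ip modulo P, turns it into the claimed congruence for the y's.
--  (a) If p ∣ y_k then p ∣ X k. At k = ip this contradicts p ∤ y_ip. Otherwise p
--      divides both or neither of A k, B k; "both" makes M·p divide c_ip by (1),
--      against minimality of m, and "neither" is excluded by genericity of y_ip.

quot-cofactor : ∀ d u → d ∣ u → u ≡ d ℕ.* quot u d
quot-cofactor zero    u d∣u = 0∣⇒≡0 d∣u
quot-cofactor (suc d) u d∣u = sym (m*[n/m]≡n d∣u)

quot-unique : ∀ d u q → 0 < d → u ≡ d ℕ.* q → quot u d ≡ q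
quot-unique (suc d) u q _ refl = trans (cong (_/ suc d) (ℕₚ.*-comm (suc d) q)) (m*n/n≡m q (suc d))

-- Dividing a positive multiple of p > 1 by p gives a smaller positive number,
-- so the fuel u in ν p u = νgo u p u never runs out.
quot-decreases : ∀ {p u} → 1 < p → 0 < u → p ∣ u → 0 < quot u p × quot u p < u
quot-decreases {p} {u} 1<p 0<u p∣u with quot u p | quot-cofactor p u p∣u
... | zero  | u≡0 = ⊥-elim (ℕₚ.<⇒≢ 0<u (sym (trans u≡0 (ℕₚ.*-zeroʳ p))))
... | suc w | refl = z<s , subst (suc w <_) (ℕₚ.*-comm (suc w) p) (ℕₚ.m<m*n (suc w) p 1<p)

pow-positive : ∀ {p} → 1 < p → ∀ e → 0 < p ^ e
pow-positive {p} 1<p e = ℕₚ.m^n>0 p {{>-nonZero (<-trans z<s 1<p)}} e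

νgo-factor : ∀ {p} → 1 < p → ∀ f u → 0 < u → u ≤ f →
             Σ ℕ λ Q → (u ≡ p ^ νgo f p u ℕ.* Q) × ¬ p ∣ Q
νgo-factor 1<p zero u 0<u u≤0 = ⊥-elim (ℕₚ.<⇒≱ 0<u u≤0)
νgo-factor {p} 1<p (suc f) u 0<u u≤1+f with p ∣? u
... | no  p∤u = u , sym (ℕₚ.*-identityˡ u) , p∤u
... | yes p∣u with quot-decreases 1<p 0<u p∣u
...   | 0<w , w<u with νgo-factor 1<p f (quot u p) 0<w (ℕₚ.≤-pred (ℕₚ.≤-trans w<u u≤1+f))
...     | Q , w≡ , p∤Q = Q , u≡ , p∤Q
  where
  u≡ : u ≡ p ℕ.* p ^ νgo f p (quot u p) ℕ.* Q
  u≡ = trans (quot-cofactor p u p∣u) (trans (cong (p ℕ.*_) w≡) (sym (ℕₚ.*-assoc p _ Q)))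

valuation-factor : ∀ {p u} → 1 < p → 0 < u → (u ≡ p ^ ν p u ℕ.* part p u) × ¬ p ∣ part p u
valuation-factor {p} {u} 1<p 0<u with νgo-factor 1<p u u 0<u ℕₚ.≤-refl
... | Q , u≡ , p∤Q rewrite quot-unique (p ^ ν p u) u Q (pow-positive 1<p (ν p u)) u≡
  = u≡ , p∤Q

pow-∣-pow : ∀ p {a b} → a ≤ b → p ^ a ∣ p ^ b
pow-∣-pow p {a} {b} a≤b = divides (p ^ (b ∸ a)) (begin
  p ^ b                 ≡⟨ cong (p ^_) (ℕₚ.m+[n∸m]≡n a≤b) ⟨
  p ^ (a ℕ.+ (b ∸ a))   ≡⟨ ℕₚ.^-distribˡ-+-* p a (b ∸ a) ⟩
  p ^ a ℕ.* p ^ (b ∸ a) ≡⟨ ℕₚ.*-comm (p ^ a) _ ⟩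
  p ^ (b ∸ a) ℕ.* p ^ a ∎)
  where open ≡-Reasoning

lower-exponent-∣ : ∀ {p a b A B} → 1 < p → a < b → p ^ a ℕ.* A ≡ p ^ b ℕ.* B → p ∣ A
lower-exponent-∣ {p} {a} {b} {A} {B} 1<p a<b eq =
  *-cancelˡ-∣ (p ^ a) {{>-nonZero (pow-positive 1<p a)}} (subst₂ _∣_ (ℕₚ.*-comm p (p ^ a)) (sym eq)
    (∣-trans (pow-∣-pow p a<b) (∣m⇒∣m*n B ∣-refl)))

exponent-unique : ∀ {p a b A B} → 1 < p → p ^ a ℕ.* A ≡ p ^ b ℕ.* B → ¬ p ∣ A → ¬ p ∣ B → a ≡ b
exponent-unique {a = a} {b} 1<p eq p∤A p∤B with <-cmp a b
... | tri< a<b _ _ = ⊥-elim (p∤A (lower-exponent-∣ 1<p a<b eq))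
... | tri≈ _ a≡b _ = a≡b
... | tri> _ _ b<a = ⊥-elim (p∤B (lower-exponent-∣ 1<p b<a (sym eq)))

part-unique : ∀ {p u a A} → 1 < p → u ≡ p ^ a ℕ.* A → ¬ p ∣ A → part p u ≡ A
part-unique {p} {u} {a} {A} 1<p u≡ p∤A = begin
  quot u (p ^ ν p u)  ≡⟨ cong (λ e → quot u (p ^ e)) ν≡a ⟩
  quot u (p ^ a)      ≡⟨ quot-unique (p ^ a) u A (pow-positive 1<p a) u≡ ⟩
  A                   ∎
  where
  open ≡-Reasoning
  0<A : 0 < A
  0<A = ℕₚ.n≢0⇒n>0 λ { refl → p∤A (p ∣0) }
  0<u : 0 < u
  0<u = subst (0 <_) (sym u≡) (ℕₚ.*-mono-< (pow-positive 1<p a) 0<A)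
  u-factor : u ≡ p ^ ν p u ℕ.* part p u
  u-factor = proj₁ (valuation-factor 1<p 0<u)
  p∤part : ¬ p ∣ part p u
  p∤part = proj₂ (valuation-factor 1<p 0<u)
  ν≡a : ν p u ≡ a
  ν≡a = exponent-unique 1<p (trans (sym u-factor) u≡) p∤part p∤A

pow-∣-of-≤-valuation : ∀ {p u e} → 1 < p → 0 < u → e ≤ ν p u → p ^ e ∣ u
pow-∣-of-≤-valuation {p} {u} 1<p 0<u e≤ν =
  ∣-trans (pow-∣-pow p e≤ν) (divides (part p u) (trans (proj₁ (valuation-factor 1<p 0<u)) (ℕₚ.*-comm (p ^ ν p u) _)))

∣-pow-valuation : ∀ {p} u → 0 < u → p ∣ u → p ∣ p ^ ν p u
∣-pow-valuation {p} (suc t) _ p∣u with p ∣? suc t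
... | yes _   = ∣m⇒∣m*n _ ∣-refl
... | no  p∤u = ⊥-elim (p∤u p∣u)

common-divisor-third-side : ∀ {n c i j k d} → TriangleGcd n c → i < j → j < k → k < n →
  (d ∣ c i j → d ∣ c j k → d ∣ c i k) ×
  (d ∣ c j k → d ∣ c i k → d ∣ c i j) ×
  (d ∣ c i j → d ∣ c i k → d ∣ c j k)
common-divisor-third-side {c = c} {i} {j} {k} triangles i<j j<k k<n =
    (λ d∣a d∣b → ∣-trans (subst (_ ∣_) (trans ab≡bc bc≡ac) (gcd-greatest d∣a d∣b)) (gcd[m,n]∣n (c i j) (c i k)))
  , (λ d∣b d∣c → ∣-trans (subst (_ ∣_) (sym ab≡bc) (gcd-greatest d∣b d∣c)) (gcd[m,n]∣m (c i j) (c j k)))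
  , (λ d∣a d∣c → ∣-trans (subst (_ ∣_) (sym bc≡ac) (gcd-greatest d∣a d∣c)) (gcd[m,n]∣m (c j k) (c i k)))
  where
  ab≡bc : gcd (c i j) (c j k) ≡ gcd (c j k) (c i k)
  ab≡bc = proj₁ (triangles i j k i<j j<k k<n)
  bc≡ac : gcd (c j k) (c i k) ≡ gcd (c i j) (c i k)
  bc≡ac = proj₂ (triangles i j k i<j j<k k<n)

signedAt : ℕ → (ℕ → ℤ) → (ℕ → ℤ) → ℕ → ℤ
signedAt ip below above k with <-cmp k ip
... | tri< _ _ _ = - below k
... | tri≈ _ _ _ = 0ℤ
... | tri> _ _ _ = above k

signedAt-scale : ∀ {ip k} {f g f′ g′ : ℕ → ℤ} (m : ℤ) →
  (k < ip → f k ≡ m * f′ k) → (ip < k → g k ≡ m * g′ k) →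
  signedAt ip f g k ≡ m * signedAt ip f′ g′ k
signedAt-scale {ip} {k} {f′ = f′} m f≡ g≡ with <-cmp k ip
... | tri< k<ip _ _ = trans (cong -_ (f≡ k<ip)) (neg-distribʳ-* m (f′ k))
... | tri≈ _ _ _    = sym (*-zeroʳ m)
... | tri> _ _ ip<k = g≡ ip<k

signedAt-∣ : ∀ {ip k d} {f : ℕ → ℤ} → k ≢ ip →
  (d ℤ∣.∣ signedAt ip f f k → d ℤ∣.∣ f k) × (d ℤ∣.∣ f k → d ℤ∣.∣ signedAt ip f f k)
signedAt-∣ {ip} {k} {f = f} k≢ip with <-cmp k ip
... | tri< _ _ _    = (λ d∣-f → subst (_ ℤ∣.∣_) (neg-involutive (f k)) (ℤ∣.∣m⇒∣-m d∣-f)) , ℤ∣.∣m⇒∣-m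
... | tri≈ _ k≡ip _ = ⊥-elim (k≢ip k≡ip)
... | tri> _ _ _    = (λ d∣f → d∣f) , (λ d∣f → d∣f)

ptolemyℤ : ∀ {n c i j k l} → IsPosFrieze n c → i < j → j < k → k < l → l < n →
  + c i k * + c j l ≡ + c i l * + c j k + + c i j * + c k l
ptolemyℤ {c = c} {i} {j} {k} {l} frieze i<j j<k k<l l<n = begin
  + c i k * + c j l                    ≡⟨ pos-* (c i k) (c j l) ⟨
  + (c i k ℕ.* c j l)                  ≡⟨ cong +_ (IsPosFrieze.ptolemy frieze i j k l i<j j<k k<l l<n) ⟩
  + (c i l ℕ.* c j k ℕ.+ c i j ℕ.* c k l) ≡⟨ pos-+ (c i l ℕ.* c j k) _ ⟩
  + (c i l ℕ.* c j k) + + (c i j ℕ.* c k l) ≡⟨ cong₂ _+_ (pos-* (c i l) (c j k)) (pos-* (c i j) (c k l)) ⟩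
  + c i l * + c j k + + c i j * + c k l ∎
  where open ≡-Reasoning

neg-neg : ∀ a b x y → a * - b - x * - y ≡ y * x - a * b
neg-neg = solve-∀

sub-neg : ∀ u x y → u - x * - y ≡ u + y * x
sub-neg = solve-∀

neg-at-pivot : ∀ a x y → a * 0ℤ - x * - y ≡ x * y
neg-at-pivot = solve-∀

sub-zero : ∀ u x → u - x * 0ℤ ≡ u
sub-zero = solve-∀

add-sub-cancelˡ : ∀ v w → v + w - v ≡ w
add-sub-cancelˡ = solve-∀

add-sub-cancelʳ : ∀ v w → v + w - w ≡ v
add-sub-cancelʳ = solve-∀

-- The signed chord σ k is - c(k,ip) below the
-- pivot and c(ip,k) above it; the Ptolemy relations of the quadrilaterals
-- containing ip and N then take the single form of signed-ptolemy.
module SignedChords {n c} (frieze : IsPosFrieze n c) {N} (N<n : N < n) {ip} (ip<N : ip < N) where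

  open ≡-Reasoning

  C : ℕ → ℕ → ℤ
  C a b = + c a b

  σ : ℕ → ℤ
  σ = signedAt ip (λ k → C k ip) (λ k → C ip k)

  signed-ptolemy : ∀ {i k} → i < k → k < N → C i N * σ k - C k N * σ i ≡ C ip N * C i k
  signed-ptolemy {i} {k} i<k k<N with <-cmp i ip | <-cmp k ip
  ... | tri< i<ip _ _ | tri< k<ip _ _ = begin
    C i N * - C k ip - C k N * - C i ip                  ≡⟨ neg-neg (C i N) (C k ip) (C k N) (C i ip) ⟩
    C i ip * C k N - C i N * C k ip                      ≡⟨ cong (_- C i N * C k ip) (ptolemyℤ frieze i<k k<ip ip<N N<n) ⟩
    C i N * C k ip + C i k * C ip N - C i N * C k ip     ≡⟨ add-sub-cancelˡ (C i N * C k ip) (C i k * C ip N) ⟩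
    C i k * C ip N                                       ≡⟨ *-comm (C i k) (C ip N) ⟩
    C ip N * C i k                                       ∎
  ... | tri< i<ip _ _ | tri≈ _ refl _ = neg-at-pivot (C i N) (C ip N) (C i ip)
  ... | tri< i<ip _ _ | tri> _ _ ip<k = begin
    C i N * C ip k - C k N * - C i ip                    ≡⟨ sub-neg (C i N * C ip k) (C k N) (C i ip) ⟩
    C i N * C ip k + C i ip * C k N                      ≡⟨ ptolemyℤ frieze i<ip ip<k k<N N<n ⟨
    C i k * C ip N                                       ≡⟨ *-comm (C i k) (C ip N) ⟩
    C ip N * C i k                                       ∎
  ... | tri≈ _ refl _ | tri> _ _ ip<k = sub-zero (C ip N * C ip k) (C k N)
  ... | tri> _ _ ip<i | tri> _ _ ip<k = begin
    C i N * C ip k - C k N * C ip i                      ≡⟨ cong₂ _-_ (*-comm (C i N) (C ip k)) (*-comm (C k N) (C ip i)) ⟩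
    C ip k * C i N - C ip i * C k N                      ≡⟨ cong (_- C ip i * C k N) (ptolemyℤ frieze ip<i i<k k<N N<n) ⟩
    C ip N * C i k + C ip i * C k N - C ip i * C k N     ≡⟨ add-sub-cancelʳ (C ip N * C i k) (C ip i * C k N) ⟩
    C ip N * C i k                                       ∎
  ... | tri≈ _ refl _ | tri< k<ip _ _ = ⊥-elim (<-asym i<k k<ip)
  ... | tri≈ _ refl _ | tri≈ _ k≡ip _ = ⊥-elim (<-irrefl (sym k≡ip) i<k)
  ... | tri> _ _ ip<i | tri< k<ip _ _ = ⊥-elim (<-asym (<-trans ip<i i<k) k<ip)
  ... | tri> _ _ ip<i | tri≈ _ refl _ = ⊥-elim (<-asym ip<i i<k)

∣⇒≡0-mod : ∀ {q x} → + q ℤ∣.∣ x → x ≡ + 0 [mod q ]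
∣⇒≡0-mod {q} {x} q∣x = subst (+ q ℤD.∣_) (sym (+-identityʳ x)) (ℤ∣.∣⇒∣ᵤ q∣x)

prime-∣-* : ∀ {p} → Prime p → ∀ a b → + p ℤ∣.∣ a * b → + p ℤ∣.∣ a ⊎ + p ℤ∣.∣ b
prime-∣-* p-prime a b p∣ab with euclidsLemma ∣ a ∣ ∣ b ∣ p-prime (subst (_ ∣_) (abs-* a b) (ℤ∣.∣⇒∣ᵤ p∣ab))
... | inj₁ p∣a = inj₁ (ℤ∣.∣ᵤ⇒∣ p∣a)
... | inj₂ p∣b = inj₂ (ℤ∣.∣ᵤ⇒∣ p∣b)

∣-target : ∀ {q y inv x a} → q ℤ∣.∣ y - inv * x → q ℤ∣.∣ y → q ℤ∣.∣ inv * a - 1ℤ → q ℤ∣.∣ x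
∣-target {q} {y} {inv} {x} {a} q∣y-inv·x q∣y q∣inv·a-1 = subst (q ℤ∣.∣_) (regroup y inv x a)
  (ℤ∣.∣m∣n⇒∣m-n (ℤ∣.∣m∣n⇒∣m-n (ℤ∣.∣n⇒∣m*n a q∣y) (ℤ∣.∣n⇒∣m*n a q∣y-inv·x)) (ℤ∣.∣m⇒∣m*n x q∣inv·a-1))
  where
  regroup : ∀ y inv x a → a * y - a * (y - inv * x) - (inv * a - 1ℤ) * x ≡ x
  regroup = solve-∀

inverse-target : ∀ {q inv a} y → q ℤ∣.∣ inv * a - 1ℤ → q ℤ∣.∣ y - inv * (a * y + 0ℤ)
inverse-target {q} {inv} {a} y q∣inv·a-1 = subst (q ℤ∣.∣_) (regroup inv a y) (ℤ∣.∣m⇒∣-m (ℤ∣.∣m⇒∣m*n y q∣inv·a-1))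
  where
  regroup : ∀ inv a y → - ((inv * a - 1ℤ) * y) ≡ y - inv * (a * y + 0ℤ)
  regroup = solve-∀

transfer-congruence : ∀ {q} ci ck cik inv a xi xk yi yk → ci * xk - ck * xi ≡ a * cik →
  q ℤ∣.∣ yi - inv * xi → q ℤ∣.∣ yk - inv * xk → q ℤ∣.∣ inv * a - 1ℤ →
  q ℤ∣.∣ ci * yk - (ck * yi + cik)
transfer-congruence {q} ci ck cik inv a xi xk yi yk rel q∣i q∣k q∣inv =
  subst (q ℤ∣.∣_) (sym (regroup ci ck cik inv a xi xk yi yk))
    (ℤ∣.∣m∣n⇒∣m+n (ℤ∣.∣m∣n⇒∣m+n (ℤ∣.∣m∣n⇒∣m-n (ℤ∣.∣n⇒∣m*n ci q∣k) (ℤ∣.∣n⇒∣m*n ck q∣i)) (ℤ∣.∣n⇒∣m*n cik q∣inv))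
      (ℤ∣.∣n⇒∣m*n inv (subst (q ℤ∣.∣_) (sym (i≡j⇒i-j≡0 rel)) (ℤ∣.divides 0ℤ refl))))
  where
  regroup : ∀ ci ck cik inv a xi xk yi yk → ci * yk - (ck * yi + cik) ≡
    ci * (yk - inv * xk) - ck * (yi - inv * xi) + cik * (inv * a - 1ℤ) + inv * (ci * xk - ck * xi - a * cik)
  regroup = solve-∀

-- Dividing a relation ci·σk - ck·σi = cip·cik by the factor m common to all of
-- ci, ck, cip, σi, σk; the "target" terms aj·t + sj may be added for free since
-- their t-parts cancel.
cancel-common-factor : ∀ m {ai ak aip si sk cik ci ck cip σi σk} (t : ℤ) → .{{NonZero m}} →
  ci ≡ m * ai → ck ≡ m * ak → cip ≡ m * aip → σi ≡ m * si → σk ≡ m * sk →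
  ci * σk - ck * σi ≡ cip * cik → ci * (ak * t + sk) - ck * (ai * t + si) ≡ aip * cik
cancel-common-factor m {ai} {ak} {aip} {si} {sk} {cik} t refl refl refl refl refl rel =
  *-cancelˡ-≡ m _ _ (begin
    m * ((m * ai) * (ak * t + sk) - (m * ak) * (ai * t + si)) ≡⟨ expand m ai ak si sk t ⟩
    (m * ai) * (m * sk) - (m * ak) * (m * si)                 ≡⟨ rel ⟩
    (m * aip) * cik                                           ≡⟨ *-assoc m aip cik ⟩
    m * (aip * cik)                                           ∎)
  where
  open ≡-Reasoning
  expand : ∀ m ai ak si sk t → m * ((m * ai) * (ak * t + sk) - (m * ak) * (ai * t + si)) ≡ (m * ai) * (m * sk) - (m * ak) * (m * si)
  expand = solve-∀

-- Every leg is divisible by M,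
-- and by condition (1) so is every chord c(ip,k); A k and B k are the reduced
-- leg and chord, s the reduced signed chord, and X t k = A k · t + s k is the
-- value that y k must take (up to the factor inv) once y ip = t is chosen.
module ReducedLabels {n c} (frieze : IsPosFrieze n c) (triangles : TriangleGcd n c)
  {N} (N<n : N < n) {ip} (ip<N : ip < N) {p} (1<p : 1 < p)
  (ip-minimal : ∀ k → k < N → ν p (c ip N) ≤ ν p (c k N)) where

  open IsPosFrieze frieze
  open SignedChords frieze N<n ip<N

  M : ℕ
  M = p ^ ν p (c ip N)

  A B : ℕ → ℕ
  A k = quot (c k N) M
  B k = quot (c ip k) M

  s : ℕ → ℤ
  s = signedAt ip (λ k → + B k) (λ k → + B k)

  X : ℤ → ℕ → ℤ
  X t k = + A k * t + s k

  instance
    M-nonZero : ℕ.NonZero M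
    M-nonZero = >-nonZero (pow-positive 1<p (ν p (c ip N)))

  M∣leg : ∀ {k} → k < N → M ∣ c k N
  M∣leg {k} k<N = pow-∣-of-≤-valuation 1<p (positive k N k<N N<n) (ip-minimal k k<N)

  leg-factor : ∀ {k} → k < N → c k N ≡ M ℕ.* A k
  leg-factor {k} k<N = quot-cofactor M (c k N) (M∣leg k<N)

  pivot-triangle : ∀ {k d} → k < N → k ≢ ip →
    (d ∣ c k N → d ∣ c ip N → d ∣ c ip k) × (d ∣ c k N → d ∣ c ip k → d ∣ c ip N)
  pivot-triangle {k} k<N k≢ip with <-cmp k ip
  ... | tri< k<ip _ _ =
    let _ , chord , leg = common-divisor-third-side triangles k<ip ip<N N<n
        chord≡ = symm k ip (<-trans k<N N<n) (<-trans ip<N N<n)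
    in (λ d∣kN d∣ipN → subst (_ ∣_) chord≡ (chord d∣ipN d∣kN))
     , (λ d∣kN d∣chord → leg (subst (_ ∣_) (sym chord≡) d∣chord) d∣kN)
  ... | tri≈ _ k≡ip _ = ⊥-elim (k≢ip k≡ip)
  ... | tri> _ _ ip<k =
    let leg , chord , _ = common-divisor-third-side triangles ip<k k<N N<n
    in (λ d∣kN d∣ipN → chord d∣kN d∣ipN) , (λ d∣kN d∣chord → leg d∣chord d∣kN)

  chord-factor : ∀ {k} → k < N → k ≢ ip → c ip k ≡ M ℕ.* B k
  chord-factor {k} k<N k≢ip = quot-cofactor M (c ip k)
    (proj₁ (pivot-triangle k<N k≢ip) (M∣leg k<N) (M∣leg ip<N))

  lift-factor : ∀ {u v} → u ≡ M ℕ.* v → + u ≡ + M * + v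
  lift-factor {u} {v} u≡ = trans (cong +_ u≡) (pos-* M v)

  σ-factor : ∀ {k} → k < N → σ k ≡ + M * s k
  σ-factor {k} k<N = signedAt-scale (+ M)
    (λ k<ip → lift-factor (trans (symm k ip (<-trans k<N N<n) (<-trans ip<N N<n))
                                 (chord-factor k<N (ℕₚ.<⇒≢ k<ip))))
    (λ ip<k → lift-factor (chord-factor k<N (ℕₚ.>⇒≢ ip<k)))

  -- The signed Ptolemy relation divided by M: the targets X t satisfy the
  -- exact relation that part (b) asks of the y's modulo p ^ ℓ, up to the factor A ip.
  target-relation : ∀ t {i k} → i < k → k < N → C i N * X t k - C k N * X t i ≡ + A ip * C i k
  target-relation t i<k k<N = cancel-common-factor (+ M) t
    (lift-factor (leg-factor (<-trans i<k k<N))) (lift-factor (leg-factor k<N)) (lift-factor (leg-factor ip<N))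
    (σ-factor (<-trans i<k k<N)) (σ-factor k<N) (signed-ptolemy i<k k<N)

  -- Reduced leg and chord at k ≠ ip are never both divisible by p: otherwise
  -- M·p would divide the leg c(ip,N) by condition (1), against the minimality of m.
  no-common-factor : ∀ {k} → k < N → k ≢ ip → p ∣ A k → p ∣ B k → ⊥
  no-common-factor {k} k<N k≢ip p∣A p∣B =
    proj₂ (valuation-factor 1<p (positive ip N ip<N N<n))
      (*-cancelˡ-∣ M (subst (M ℕ.* p ∣_) (leg-factor ip<N) Mp∣ipN))
    where
    Mp∣ipN : M ℕ.* p ∣ c ip N
    Mp∣ipN = proj₂ (pivot-triangle k<N k≢ip)
      (subst (M ℕ.* p ∣_) (sym (leg-factor k<N)) (*-monoʳ-∣ M p∣A))
      (subst (M ℕ.* p ∣_) (sym (chord-factor k<N k≢ip)) (*-monoʳ-∣ M p∣B))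

  Generic : ℤ → Set
  Generic t = ∀ k → k < N → k ≢ ip → ¬ p ∣ B k → ¬ p ∣ A k →
    (k < ip → ¬ ((+ part p (c k N) * t - + part p (c ip k)) ≡ + 0 [mod p ])) ×
    (ip < k → ¬ ((+ part p (c k N) * t + + part p (c ip k)) ≡ + 0 [mod p ]))

  in-prime-free-parts : ∀ {k t} (_∙_ : ℤ → ℤ → ℤ) → k < N → k ≢ ip → ¬ p ∣ A k → ¬ p ∣ B k →
    (+ A k * t) ∙ (+ B k) ≡ + 0 [mod p ] → (+ part p (c k N) * t) ∙ (+ part p (c ip k)) ≡ + 0 [mod p ]
  in-prime-free-parts {k} {t} _∙_ k<N k≢ip p∤A p∤B = subst₂ (λ a b → (+ a * t) ∙ (+ b) ≡ + 0 [mod p ])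
    (sym (part-unique {a = ν p (c ip N)} 1<p (leg-factor k<N) p∤A)) (sym (part-unique {a = ν p (c ip N)} 1<p (chord-factor k<N k≢ip) p∤B))

  generic-target : ∀ {t k} → Generic t → k < N → k ≢ ip → ¬ p ∣ A k → ¬ p ∣ B k → ¬ (+ p ℤ∣.∣ X t k)
  generic-target {t} {k} generic k<N k≢ip p∤A p∤B with <-cmp k ip
  ... | tri< k<ip _ _ = λ p∣X → proj₁ (generic k k<N k≢ip p∤B p∤A) k<ip
          (in-prime-free-parts _-_ k<N k≢ip p∤A p∤B (∣⇒≡0-mod p∣X))
  ... | tri≈ _ k≡ip _ = ⊥-elim (k≢ip k≡ip)
  ... | tri> _ _ ip<k = λ p∣X → proj₂ (generic k k<N k≢ip p∤B p∤A) ip<k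
          (in-prime-free-parts _+_ k<N k≢ip p∤A p∤B (∣⇒≡0-mod p∣X))

  -- For k ≠ ip the target X t k is prime to p whenever t is prime to p and generic:
  -- if p divided exactly one of A k, B k it would divide the other (as p ∤ t);
  -- both is excluded by no-common-factor, neither by genericity.
  target-prime-to-p : Prime p → ∀ {t k} → ¬ (+ p ℤ∣.∣ t) → Generic t → k < N → k ≢ ip →
    ¬ (+ p ℤ∣.∣ X t k)
  target-prime-to-p p-prime {t} {k} p∤t generic k<N k≢ip p∣X with p ∣? A k | p ∣? B k
  ... | yes p∣A | yes p∣B = no-common-factor k<N k≢ip p∣A p∣B
  ... | yes p∣A | no  p∤B = p∤B (ℤ∣.∣⇒∣ᵤ (proj₁ (signedAt-∣ k≢ip)
          (ℤ∣.∣m+n∣m⇒∣n p∣X (ℤ∣.∣m⇒∣m*n t (ℤ∣.∣ᵤ⇒∣ {+ p} {+ A k} p∣A)))))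
  ... | no  p∤A | no  p∤B = generic-target generic k<N k≢ip p∤A p∤B p∣X
  ... | no  p∤A | yes p∣B with prime-∣-* p-prime (+ A k) t
          (ℤ∣.∣m+n∣n⇒∣m p∣X (proj₂ (signedAt-∣ k≢ip) (ℤ∣.∣ᵤ⇒∣ {+ p} {+ B k} p∣B)))
  ...   | inj₁ p∣A = p∤A (ℤ∣.∣⇒∣ᵤ p∣A)
  ...   | inj₂ p∣t = p∤t p∣t

  targets-met : ∀ {Q inv} {y : ℕ → ℤ} → + Q ℤ∣.∣ inv * + A ip - 1ℤ →
    (∀ k → k < N → k < ip → y k ≡ inv * (+ A k * y ip - + B k) [mod Q ]) →
    (∀ k → k < N → ip < k → y k ≡ inv * (+ A k * y ip + + B k) [mod Q ]) →
    ∀ k → k < N → + Q ℤ∣.∣ y k - inv * X (y ip) k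
  targets-met {inv = inv} {y} inv-spec below above k k<N with <-cmp k ip
  ... | tri< k<ip _ _ = ℤ∣.∣ᵤ⇒∣ (below k k<N k<ip)
  ... | tri≈ _ refl _ = inverse-target {inv = inv} (y ip) inv-spec
  ... | tri> _ _ ip<k = ℤ∣.∣ᵤ⇒∣ (above k k<N ip<k)

  congruences : ∀ {q inv t} {y : ℕ → ℤ} → q ℤ∣.∣ inv * + A ip - 1ℤ →
    (∀ k → k < N → q ℤ∣.∣ y k - inv * X t k) →
    ∀ {i k} → i < k → k < N → q ℤ∣.∣ C i N * y k - (C k N * y i + C i k)
  congruences {inv = inv} {t} {y} inv-spec targets {i} {k} i<k k<N =
    transfer-congruence (C i N) (C k N) (C i k) inv (+ A ip) (X t i) (X t k) (y i) (y k) (target-relation t i<k k<N)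
    (targets i (<-trans i<k k<N)) (targets k k<N) inv-spec

  y-prime-to-p : Prime p → ∀ {q inv} {y : ℕ → ℤ} → + p ℤ∣.∣ q → q ℤ∣.∣ inv * + A ip - 1ℤ →
    (∀ k → k < N → q ℤ∣.∣ y k - inv * X (y ip) k) → ¬ (+ p ℤ∣.∣ y ip) → Generic (y ip) →
    ∀ k → k < N → ¬ (+ p ℤ∣.∣ y k)
  y-prime-to-p p-prime {inv = inv} p∣q inv-spec targets p∤yip generic k k<N p∣yk with k ℕ.≟ ip
  ... | yes refl  = p∤yip p∣yk
  ... | no  k≢ip  = target-prime-to-p p-prime p∤yip generic k<N k≢ip
    (∣-target {inv = inv} {a = + A ip} (ℤ∣.∣-trans p∣q (targets k k<N)) p∣yk (ℤ∣.∣-trans p∣q inv-spec))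

last-vertex : ∀ {n} → 2 ≤ n → n ∸ 1 < n
last-vertex (s≤s (s≤s _)) = ℕₚ.n<1+n _

lemma4p4 : (n : ℕ) → 2 ≤ n → (c : ℕ → ℕ → ℕ) → IsPosFrieze n c →
  TriangleGcd n c → SubpolygonValuation n c →
  1 < c 0 (n ∸ 1) →
  (p : ℕ) → Prime p → p ∣ c 0 (n ∸ 1) →
  (ip : ℕ) → ip < n ∸ 1 →
  (∀ i → i < n ∸ 1 → ν p (c ip (n ∸ 1)) ≤ ν p (c i (n ∸ 1))) →
  (inv : ℤ) → (inv * + part p (c ip (n ∸ 1))) ≡ + 1 [mod p ^ ν p (c 0 (n ∸ 1)) ] →
  (y : ℕ → ℤ) →
  + 0 <ℤ y ip →
  ¬ (y ip ≡ + 0 [mod p ]) →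
  (∀ j → j < n ∸ 1 → j ≢ ip →
    ¬ (p ∣ quot (c ip j) (p ^ ν p (c ip (n ∸ 1)))) →
    ¬ (p ∣ quot (c j (n ∸ 1)) (p ^ ν p (c ip (n ∸ 1)))) →
    (j < ip → ¬ ((+ part p (c j (n ∸ 1)) * y ip - + part p (c ip j)) ≡ + 0 [mod p ])) ×
    (ip < j → ¬ ((+ part p (c j (n ∸ 1)) * y ip + + part p (c ip j)) ≡ + 0 [mod p ]))) →
  (∀ j → j < n ∸ 1 → j < ip →
    y j ≡ inv * (+ quot (c j (n ∸ 1)) (p ^ ν p (c ip (n ∸ 1))) * y ip
                 - + quot (c ip j) (p ^ ν p (c ip (n ∸ 1)))) [mod p ^ ν p (c 0 (n ∸ 1)) ]) →
  (∀ j → j < n ∸ 1 → ip < j →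
    y j ≡ inv * (+ quot (c j (n ∸ 1)) (p ^ ν p (c ip (n ∸ 1))) * y ip
                 + + quot (c ip j) (p ^ ν p (c ip (n ∸ 1)))) [mod p ^ ν p (c 0 (n ∸ 1)) ]) →
  ∀ j → j < n ∸ 1 →
    ¬ (+ p ℤD.∣ gcdℤ (y j) (+ c j (n ∸ 1))) ×
    (∀ i → i < j →
      (+ c i (n ∸ 1) * y j) ≡ (+ c j (n ∸ 1) * y i + + c i j) [mod p ^ ν p (c 0 (n ∸ 1)) ])
lemma4p4 n 2≤n c frieze triangles _ 1<c₀ p p-prime p∣c₀ ip ip<N ip-minimal inv inv-spec
         y _ y-unit y-generic y-below y-above j j<N =
    (λ p∣gcd → y-prime-to-p p-prime {inv = inv} {y} p∣P inv-spec′ targets p∤y-ip y-generic j j<N (gcd-∣ p∣gcd))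
  , (λ i i<j → ℤ∣.∣⇒∣ᵤ (congruences {inv = inv} {y ip} {y} inv-spec′ targets i<j j<N))
  where
  open ReducedLabels frieze triangles (last-vertex 2≤n) ip<N
         (nonTrivial⇒n>1 p {{prime⇒nonTrivial p-prime}}) ip-minimal

  P : ℕ
  P = p ^ ν p (c 0 (n ∸ 1))

  p∣P : + p ℤ∣.∣ + P
  p∣P = ℤ∣.∣ᵤ⇒∣ (∣-pow-valuation (c 0 (n ∸ 1)) (<-trans z<s 1<c₀) p∣c₀)

  inv-spec′ : + P ℤ∣.∣ inv * + A ip - 1ℤ
  inv-spec′ = ℤ∣.∣ᵤ⇒∣ inv-spec

  targets : ∀ k → k < n ∸ 1 → + P ℤ∣.∣ y k - inv * X (y ip) k
  targets = targets-met {inv = inv} {y} inv-spec′ y-below y-above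

  p∤y-ip : ¬ (+ p ℤ∣.∣ y ip)
  p∤y-ip p∣y-ip = y-unit (∣⇒≡0-mod {p} {y ip} p∣y-ip)

  gcd-∣ : + p ℤD.∣ gcdℤ (y j) (+ c j (n ∸ 1)) → + p ℤ∣.∣ y j
  gcd-∣ p∣gcd = ℤ∣.∣ᵤ⇒∣ (∣-trans p∣gcd (gcd[i,j]∣i (y j) (+ c j (n ∸ 1))))
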